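{- Let $G=(V,L\cup R)$ be a partitioned digraph and let $\Gamma$ be an upward book embedding of $G$ in two pages. Let $(\mathcal E,\lambda)$ be the upward embedding of $G$ defined by $\Gamma$ (i.e., $\mathcal E$ is the planar embedding of the drawing associated with $\Gamma$ and $\lambda=\lambda_\Gamma$). Then $(\mathcal E,\lambda)$ is 4-modal.
   Context: A partitioned digraph $G=(V,L\cup R)$ is a finite simple digraph whose edge set is partitioned into $L$ ("left edges") and $R$ ("right edges"). An upward book embedding (in two pages) of an $n$-vertex partitioned digraph is a bijection $\pi:V\to\{1,\dots,n\}$ such that $\pi(u)<\pi(v)$ for every edge $(u,v)$, and no two edges $(u,v),(w,x)$ in the same part ($L$ or $R$) cross, i.e., neither $\pi(u)<\pi(w)<\pi(v)<\pi(x)$ nor $\pi(w)<\pi(u)<\pi(x)<\pi(v)$. It determines a drawing: vertex $v$ is placed at $(0,\pi(v))$ on a vertical line (the spine), each edge of $L$ (resp. $R$) is a semicircle joining its endpoints to the left (resp. right) of the spine; this drawing is planar and upward (each edge is a curve strictly increasing in $y$ from tail to head). Its planar embedding $\mathcal E$ is given by the clockwise orders of edges around vertices (plus outer face / relative positions of components). An angle at $v$ is a pair $(e_1,e_2)$ of edges at $v$ with $e_2$ immediately following $e_1$ clockwise around $v$; it is a switch angle if $v$ is the head of both or the tail of both, otherwise flat. The angle assignment $\lambda_\Gamma$ assigns $0$ to flat angles, and to a switch angle assigns $-1$ if the corresponding geometric angle (clockwise from $e_1$ to $e_2$) in the drawing is less than $\pi$ and $+1$ if it is greater than $\pi$ ("small"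 and "large" angles). The pair $(\mathcal E,\lambda_\Gamma)$ is the upward embedding defined by $\Gamma$. A vertex $v$ is 4-modal in $(\mathcal E,\lambda)$ if: (i) when $v$ is neither a source nor a sink, in clockwise order around $v$ one finds all outgoing left edges, then all outgoing right edges, then all incoming right edges, then all incoming left edges (one of the first two sets and/or one of the last two may be empty); (ii) when $v$ is a source (resp. sink), in clockwise order around $v$ one finds the large angle at $v$, then all outgoing left edges, then all outgoing right edges (resp. the large angle, then all incoming right edges, then all incoming left edges), where one of the two sets may be empty. $(\mathcal E,\lambda)$ is 4-modal if all vertices are 4-modal. -}

module Defs where

open import Data.Nat using (ℕ; zero; suc; _∸_)
import Data.Nat as ℕ
open import Data.Fin using (Fin; toℕ)
import Data.Fin as Fin
open import Data.Bool using (Bool; true; false; T; not; _∧_; _∨_; if_then_else_)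
open import Data.Maybe using (Maybe; just; nothing)
open import Data.Integer using (ℤ; +_; -[1+_])
import Data.Integer as ℤ
import Data.Integer.Properties as ℤP
open import Data.Rational.Unnormalised using (ℚᵘ; mkℚᵘ; 0ℚᵘ)
import Data.Rational.Unnormalised as Q
import Data.Rational.Unnormalised.Properties as QP
open import Data.Product using (Σ; ∃; ∃-syntax; _×_; _,_; proj₁; proj₂)
open import Data.Sum using (_⊎_)
open import Data.List using (List; []; _∷_; _++_; map)
open import Data.List.Membership.Propositional using (_∈_)
open import Data.List.Relation.Unary.Linked using (Linked)
open import Relation.Binary.PropositionalEquality using (_≡_)
open import Relation.Nullary using (¬_; does)
open import Function.Definitions using (Bijective)

data Side : Set where
  Lft Rgt : Side

-- For each ordered pair
-- (u , w), 'edge u w' is 'nothing' if (u , w) is not an edge, 'just Lft'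
-- if (u , w) ∈ L and 'just Rgt' if (u , w) ∈ R.  This encodes a simple
-- digraph (no multi-edges) whose edge set is partitioned into L and R.
record PDigraph (n : ℕ) : Set where
  field
    edge     : Fin n → Fin n → Maybe Side
    loopless : ∀ v → edge v v ≡ nothing
open PDigraph public

sideIs : Maybe Side → Side → Bool
sideIs (just Lft) Lft = true
sideIs (just Rgt) Rgt = true
sideIs _          _   = false

-- π : V → {1..n} encoded as a bijection Fin n → Fin n (positions 0..n-1),
-- compared through toℕ.
record IsUpwardBookEmbedding {n : ℕ} (G : PDigraph n) (π : Fin n → Fin n) : Set where
  field
    bijective : Bijective _≡_ _≡_ π
    upward    : ∀ u w s → edge G u w ≡ just s → toℕ (π u) ℕ.< toℕ (π w)
    noCross₁  : ∀ u v w x s → edge G u v ≡ just s → edge G w x ≡ just s →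
                ¬ (toℕ (π u) ℕ.< toℕ (π w) × toℕ (π w) ℕ.< toℕ (π v) × toℕ (π v) ℕ.< toℕ (π x))
    noCross₂  : ∀ u v w x s → edge G u v ≡ just s → edge G w x ≡ just s →
                ¬ (toℕ (π w) ℕ.< toℕ (π u) × toℕ (π u) ℕ.< toℕ (π x) × toℕ (π x) ℕ.< toℕ (π v))

-- out : v is the tail of the edge;  inc : v is the head of the edge.
data Dir : Set where
  out inc : Dir

sameDir : Dir → Dir → Bool
sameDir out out = true
sameDir inc inc = true
sameDir _   _   = false

edgeAt : ∀ {n} → PDigraph n → Fin n → Fin n → Dir → Side → Bool
edgeAt G v w out s = sideIs (edge G v w) s
edgeAt G v w inc s = sideIs (edge G w v) s

record Dart {n : ℕ} (G : PDigraph n) (v : Fin n) : Set where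
  constructor dart
  field
    other   : Fin n
    dir     : Dir
    side    : Side
    present : T (edgeAt G v other dir side)
open Dart public

-- The clockwise order of the edges around v is given by a list, read
-- cyclically (any cyclic shift represents the same rotation).
-- λ assigns a value to each angle (e₁ , e₂) at v.
record UpwardEmbedding {n : ℕ} (G : PDigraph n) : Set where
  field
    rot : (v : Fin n) → List (Dart G v)
    lam : (v : Fin n) → Dart G v → Dart G v → ℤ
open UpwardEmbedding public

-- (e₁ , e₂) is an angle of the cyclic list l: e₂ immediately follows e₁.
CycAdj : ∀ {A : Set} → List A → A → A → Set
CycAdj l e₁ e₂ =
  (∃[ xs ] ∃[ ys ] l ≡ xs ++ (e₁ ∷ e₂ ∷ ys))
  ⊎ (∃[ xs ] l ≡ e₂ ∷ (xs ++ (e₁ ∷ [])))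
  ⊎ (l ≡ e₁ ∷ [] × e₁ ≡ e₂)

lastFrom : ∀ {A : Set} → A → List A → A
lastFrom e []      = e
lastFrom e (x ∷ r) = lastFrom x r

-- Position in the 4-modal pattern: outgoing left, outgoing right,
-- incoming right, incoming left.
rank : ∀ {n} {G : PDigraph n} {v} → Dart G v → ℕ
rank d with dir d | side d
... | out | Lft = 0
... | out | Rgt = 1
... | inc | Rgt = 2
... | inc | Lft = 3

Source Sink : ∀ {n} → PDigraph n → Fin n → Set
Source G v = ∀ w → edge G w v ≡ nothing
Sink   G v = ∀ w → edge G v w ≡ nothing

-- Clockwise the list l (a cyclic shift of rot v) is : all outgoing left,
-- all outgoing right, all incoming right, all incoming left.
Modal : ∀ {n} {G : PDigraph n} {v} → List (Dart G v) → Set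
Modal l = Linked ℕ._≤_ (map rank l)

-- Source / sink case: in clockwise order, the large angle (λ = +1), then
-- the edges in modal order.
ModalWithLargeAngle : ∀ {n} {G : PDigraph n} → UpwardEmbedding G → Fin n → Set
ModalWithLargeAngle 𝓔 v =
  ∃[ xs ] ∃[ ys ] ∃[ e ] ∃[ r ]
    (rot 𝓔 v ≡ xs ++ ys × ys ++ xs ≡ e ∷ r ×
     lam 𝓔 v (lastFrom e r) e ≡ + 1 × Modal (e ∷ r))

-- 4-modality of a vertex.  A vertex without incident edges has no angles
-- and is regarded as (vacuously) 4-modal.
FourModalAt : ∀ {n} {G : PDigraph n} → UpwardEmbedding G → Fin n → Set
FourModalAt {G = G} 𝓔 v =
  (Source G v × Sink G v)
  ⊎ ((¬ Source G v → ¬ Sink G v →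
        ∃[ xs ] ∃[ ys ] (rot 𝓔 v ≡ xs ++ ys × Modal (ys ++ xs)))
     × (Source G v → ModalWithLargeAngle 𝓔 v)
     × (Sink G v → ModalWithLargeAngle 𝓔 v))

FourModal : ∀ {n} {G : PDigraph n} → UpwardEmbedding G → Set
FourModal 𝓔 = ∀ v → FourModalAt 𝓔 v

-- Vertex v is at (0, π v); an edge of L (resp. R) is a semicircle to the
-- left (resp. right) of the spine.  Every semicircle is tangent to the
-- horizontal at its endpoints; near v, the edge to w with d = π w − π v
-- is the curve y ≈ π v + x²/d, i.e. its direction at v deviates
-- from the horizontal by an infinitesimal angle proportional to 1/d
-- (upwards for d > 0, downwards for d < 0), smaller semicircles bending
-- more.  We therefore measure directions at v as  q·(π/2) + ε·x  with
-- q ∈ ℤ, x ∈ ℚ and ε an infinitesimal, compared lexicographically.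
Ang : Set
Ang = ℤ × ℚᵘ

ltB : Ang → Ang → Bool
ltB (q₁ , x₁) (q₂ , x₂) =
  does (q₁ ℤP.<? q₂) ∨ (does (q₁ ℤ.≟ q₂) ∧ does (x₁ QP.<? x₂))

_<ᵃ_ : Ang → Ang → Set
a <ᵃ b = T (ltB a b)

-- signed reciprocal 1 / (π w − π v) of the vertical span of the edge
δ : ∀ {n} {G : PDigraph n} (π : Fin n → Fin n) {v} → Dart G v → ℚᵘ
δ π {v} d with dir d
... | out = mkℚᵘ (+ 1)    (toℕ (π (other d)) ∸ toℕ (π v) ∸ 1)
... | inc = mkℚᵘ -[1+ 0 ] (toℕ (π v) ∸ toℕ (π (other d)) ∸ 1)

-- direction of the dart at v, measured clockwise from the upward
-- vertical direction (12 o'clock): right edges leave near 3 o'clock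
-- (q = 1), left edges near 9 o'clock (q = 3).
cwPos : ∀ {n} {G : PDigraph n} (π : Fin n → Fin n) {v} → Dart G v → Ang
cwPos π d with side d
... | Rgt = (+ 1 , Q.- δ π d)
... | Lft = (+ 3 , δ π d)

-- clockwise geometric angle from e₁ to e₂, in (0 , 2π] (2π when e₁ = e₂)
cwAngle : ∀ {n} {G : PDigraph n} (π : Fin n → Fin n) {v} → Dart G v → Dart G v → Ang
cwAngle π e₁ e₂ with cwPos π e₁ | cwPos π e₂
... | (q₁ , x₁) | (q₂ , x₂) =
  if ltB (+ 0 , 0ℚᵘ) (q₂ ℤ.- q₁ , x₂ Q.- x₁)
  then (q₂ ℤ.- q₁ , x₂ Q.- x₁)
  else (q₂ ℤ.- q₁ ℤ.+ + 4 , x₂ Q.- x₁)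

-- λ_Γ : 0 on flat angles; on switch angles +1 if the clockwise angle is
-- larger than π (= (2 , 0)), −1 if it is smaller.
lamΓ : ∀ {n} {G : PDigraph n} (π : Fin n → Fin n) {v} → Dart G v → Dart G v → ℤ
lamΓ π e₁ e₂ =
  if sameDir (dir e₁) (dir e₂)
  then (if ltB (+ 2 , 0ℚᵘ) (cwAngle π e₁ e₂) then + 1 else -[1+ 0 ])
  else + 0

ClockwiseOrder : ∀ {n} {G : PDigraph n} (π : Fin n → Fin n) v → List (Dart G v) → Set
ClockwiseOrder π v l =
  (∀ d → d ∈ l) ×
  ∃[ xs ] ∃[ ys ] (l ≡ xs ++ ys × Linked (λ a b → cwPos π a <ᵃ cwPos π b) (ys ++ xs))

DefinedBy : ∀ {n} {G : PDigraph n} (π : Fin n → Fin n) → UpwardEmbedding G → Set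
DefinedBy π 𝓔 =
  (∀ v → ClockwiseOrder π v (rot 𝓔 v)) ×
  (∀ v e₁ e₂ → CycAdj (rot 𝓔 v) e₁ e₂ → lam 𝓔 v e₁ e₂ ≡ lamΓ π e₁ e₂)

-- Around a vertex v the drawing shows, clockwise from 12 o'clock: the
-- outgoing right edges (just above 3 o'clock), the incoming right edges
-- (just below it), the incoming left edges (just below 9 o'clock) and the
-- outgoing left edges (just above it); within each of these four groups the
-- edges are ordered by their offset ±δ.  Rotating the clockwise order so
-- that it starts at the outgoing left edges therefore sorts the edges
-- lexicographically by (rank, offset), i.e. in 4-modal order.  If v is a
-- source, all its edges point into the open upper half-plane, so the
-- clockwise angle from the last of them back to the first contains the
-- downward direction and is larger than π; dually for a sink.
module Submission where

open import Defs
open import Data.Nat using (ℕ)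
open import Data.Fin using (Fin)

open import Data.Bool using (true; false; T; if_then_else_)
open import Data.Empty using (⊥-elim)
open import Data.Integer using (+_)
open import Data.List using (List; []; _∷_; _++_; _∷ʳ_; head; takeWhile; dropWhile; initLast; _∷ʳ′_)
open import Data.List.Properties using (∷-injective; ++-assoc; ++-identityʳ; takeWhile++dropWhile)
open import Data.List.Relation.Binary.Permutation.Propositional using (_↭_)
open import Data.List.Relation.Binary.Permutation.Propositional.Properties using (++-comm; ∈-resp-↭)
open import Data.List.Relation.Unary.All using (All; []; _∷_)
open import Data.List.Relation.Unary.All.Properties using (all-takeWhile; all-head-dropWhile)
open import Data.List.Relation.Unary.Any.Properties using (¬Any[])
open import Data.List.Relation.Unary.Linked as Linked using (Linked; []; [-]; _∷_)
open import Data.List.Relation.Unary.Linked.Properties using (map⁺)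
open import Data.Maybe using (nothing; just)
import Data.Maybe.Relation.Unary.All as Maybe
open import Data.Nat as ℕ using (z<s; s<s)
import Data.Nat.Properties as ℕP
open import Data.Product using (∃; ∃₂; _×_; _,_; proj₁; proj₂)
import Data.Product as Product
open import Data.Product.Relation.Binary.Lex.Strict using (×-Lex; ×-transitive)
open import Data.Rational.Unnormalised as Q using (ℚᵘ; 0ℚᵘ)
import Data.Rational.Unnormalised.Properties as QP
open import Data.Sum using (_⊎_; inj₁; inj₂; [_,_])
import Data.Sum as Sum
open import Function using (_∘_; _on_)
open import Relation.Binary.Definitions using (Transitive)
open import Relation.Binary.PropositionalEquality using (_≡_; refl; sym; trans; cong; subst; isEquivalence; resp₂)
open import Relation.Nullary using (¬_; Dec; yes; does)
open import Relation.Unary using (∁)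

module _ {A : Set} where

  ++-equidivisible : ∀ (xs ys us vs : List A) → xs ++ ys ≡ us ++ vs →
                     (∃ λ cs → us ≡ xs ++ cs × ys ≡ cs ++ vs) ⊎
                     (∃ λ cs → xs ≡ us ++ cs × vs ≡ cs ++ ys)
  ++-equidivisible []       ys us       vs eq = inj₁ (us , refl , eq)
  ++-equidivisible (x ∷ xs) ys []       vs eq = inj₂ (x ∷ xs , refl , sym eq)
  ++-equidivisible (x ∷ xs) ys (u ∷ us) vs eq with ∷-injective eq
  ... | refl , eq′ with ++-equidivisible xs ys us vs eq′
  ...   | inj₁ (cs , us≡ , ys≡) = inj₁ (cs , cong (x ∷_) us≡ , ys≡)
  ...   | inj₂ (cs , xs≡ , vs≡) = inj₂ (cs , cong (x ∷_) xs≡ , vs≡)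

  IsRotation : List A → List A → Set
  IsRotation l l′ = ∃₂ λ xs ys → l ≡ xs ++ ys × ys ++ xs ≡ l′

  rotation-trans : ∀ {l l′ l″} → IsRotation l l′ → IsRotation l′ l″ → IsRotation l l″
  rotation-trans (xs , ys , refl , refl) (us , vs , eq , refl) with ++-equidivisible ys xs us vs eq
  ... | inj₁ (cs , refl , refl) = cs , vs ++ ys , ++-assoc cs vs ys , ++-assoc vs ys cs
  ... | inj₂ (cs , refl , refl) = xs ++ us , cs , sym (++-assoc xs us cs) , sym (++-assoc cs xs us)

  rotation-↭ : ∀ {l l′} → IsRotation l l′ → l ↭ l′
  rotation-↭ (xs , ys , refl , refl) = ++-comm xs ys

  lastFrom-∷ʳ : ∀ (e : A) r z → lastFrom e (r ∷ʳ z) ≡ z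
  lastFrom-∷ʳ e []      z = refl
  lastFrom-∷ʳ e (x ∷ r) z = lastFrom-∷ʳ x r z

  cycAdj-last-head : ∀ (e : A) r → CycAdj (e ∷ r) (lastFrom e r) e
  cycAdj-last-head e r with initLast r
  ... | []      = inj₂ (inj₂ (refl , refl))
  ... | m ∷ʳ′ z rewrite lastFrom-∷ʳ e m z = inj₂ (inj₁ (m , refl))

  rotation-cycAdj : ∀ {l e r} → IsRotation l (e ∷ r) → CycAdj l (lastFrom e r) e
  rotation-cycAdj {e = e} {r} (xs , [] , refl , refl)
    rewrite ++-identityʳ (e ∷ r) = cycAdj-last-head e r
  rotation-cycAdj (xs , y ∷ ys , refl , refl) with initLast xs
  ... | [] rewrite ++-identityʳ ys = cycAdj-last-head y ys
  ... | m ∷ʳ′ z rewrite sym (++-assoc ys m (z ∷ [])) | lastFrom-∷ʳ y (ys ++ m) z =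
    inj₁ (m , ys , ++-assoc m (z ∷ []) (y ∷ ys))

module _ {A : Set} {R : A → A → Set} where

  Linked-++⁻ : ∀ xs {ys} → Linked R (xs ++ ys) → Linked R xs × Linked R ys
  Linked-++⁻ []           rs = [] , rs
  Linked-++⁻ (x ∷ [])     rs = [-] , Linked.tail rs
  Linked-++⁻ (x ∷ y ∷ xs) (r ∷ rs) = Product.map₁ (r ∷_) (Linked-++⁻ (y ∷ xs) rs)

  Linked-++⁺ᴬ : ∀ {P Q : A → Set} {xs ys} → (∀ {a b} → P a → Q b → R a b) →
                All P xs → All Q ys → Linked R xs → Linked R ys → Linked R (xs ++ ys)
  Linked-++⁺ᴬ join []               _        []       rys = rys
  Linked-++⁺ᴬ join (_ ∷ [])         []       [-]      []  = [-]
  Linked-++⁺ᴬ join (px ∷ [])        (qy ∷ _) [-]      rys = join px qy ∷ rys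
  Linked-++⁺ᴬ join (_ ∷ ps@(_ ∷ _)) qs       (r ∷ rs) rys = r ∷ Linked-++⁺ᴬ join ps qs rs rys

  Linked-All-closed : ∀ {P : A → Set} {x xs} → (∀ {a b} → R a b → P a → P b) →
                      P x → Linked R (x ∷ xs) → All P (x ∷ xs)
  Linked-All-closed step px [-]      = px ∷ []
  Linked-All-closed step px (r ∷ rs) = px ∷ Linked-All-closed step (step r px) rs

  Linked-head-last : Transitive R → ∀ {e r} → Linked R (e ∷ r) → e ≡ lastFrom e r ⊎ R e (lastFrom e r)
  Linked-head-last trans [-]      = inj₁ refl
  Linked-head-last trans (r ∷ rs) with Linked-head-last trans rs
  ... | inj₁ y≡last = inj₂ (subst (R _) y≡last r)
  ... | inj₂ r′     = inj₂ (trans r r′)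

module _ {A : Set} {R S : A → A → Set} {P : A → Set} where

  Linked-mapᴬ : ∀ {xs} → (∀ {a b} → P a → P b → R a b → S a b) →
                All P xs → Linked R xs → Linked S xs
  Linked-mapᴬ f []             []       = []
  Linked-mapᴬ f (_ ∷ [])       [-]      = [-]
  Linked-mapᴬ f (pa ∷ pb ∷ ps) (r ∷ rs) = f pa pb r ∷ Linked-mapᴬ f (pb ∷ ps) rs

does⇒ : ∀ {P : Set} (p? : Dec P) → T (does p?) → P
does⇒ (yes p) _ = p

if-T : ∀ {A : Set} {b} {x y : A} → T b → (if b then x else y) ≡ x
if-T {b = true} _ = refl

p≤q⇒p-q≯0 : ∀ {p q} → p Q.≤ q → ¬ 0ℚᵘ Q.< p Q.- q
p≤q⇒p-q≯0 p≤q 0<p-q = QP.<⇒≱ 0<p-q (QP.p≤q⇒p-q≤0 p≤q)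

-- The clockwise angle between two darts of one quadrant, from the later to
-- the earlier, wraps around the full circle.
wrapping-angle-large : ∀ x → ¬ 0ℚᵘ Q.< x →
  (+ 2 , 0ℚᵘ) <ᵃ (if does (0ℚᵘ QP.<? x) then (+ 0 , x) else (+ 4 , x))
wrapping-angle-large x x≯0 = large-unless (does (0ℚᵘ QP.<? x)) (x≯0 ∘ does⇒ (0ℚᵘ QP.<? x))
  where
    large-unless : ∀ b → ¬ T b → (+ 2 , 0ℚᵘ) <ᵃ (if b then (+ 0 , x) else (+ 4 , x))
    large-unless true  ¬b = ¬b _
    large-unless false _  = _

≡nothing⇒¬sideIs : ∀ {m s} → m ≡ nothing → ¬ T (sideIs m s)
≡nothing⇒¬sideIs refl ()

¬sideIs⇒≡nothing : ∀ {m} → (∀ s → ¬ T (sideIs m s)) → m ≡ nothing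
¬sideIs⇒≡nothing {nothing}      _ = refl
¬sideIs⇒≡nothing {just Lft} ¬side = ⊥-elim (¬side Lft _)
¬sideIs⇒≡nothing {just Rgt} ¬side = ⊥-elim (¬side Rgt _)

module _ {n : ℕ} {G : PDigraph n} {v : Fin n} where

  source⇒out : Source G v → (d : Dart G v) → dir d ≡ out
  source⇒out src (dart w out s p) = refl
  source⇒out src (dart w inc s p) = ⊥-elim (≡nothing⇒¬sideIs (src w) p)

  sink⇒inc : Sink G v → (d : Dart G v) → dir d ≡ inc
  sink⇒inc snk (dart w inc s p) = refl
  sink⇒inc snk (dart w out s p) = ⊥-elim (≡nothing⇒¬sideIs (snk w) p)

  dartless⇒source : ¬ Dart G v → Source G v
  dartless⇒source none w = ¬sideIs⇒≡nothing (λ s p → none (dart w inc s p))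

  dartless⇒sink : ¬ Dart G v → Sink G v
  dartless⇒sink none w = ¬sideIs⇒≡nothing (λ s p → none (dart w out s p))

  rank>0? : (d : Dart G v) → Dec (0 ℕ.< rank d)
  rank>0? d = 0 ℕ.<? rank d

  outLeftFirst : List (Dart G v) → List (Dart G v)
  outLeftFirst l = dropWhile rank>0? l ++ takeWhile rank>0? l

  rotation-outLeftFirst : ∀ l → IsRotation l (outLeftFirst l)
  rotation-outLeftFirst l =
    takeWhile rank>0? l , dropWhile rank>0? l , sym (takeWhile++dropWhile rank>0? l) , refl

module _ {n : ℕ} {G : PDigraph n} (π : Fin n → Fin n) {v : Fin n} where

  _<ᶜʷ_ : Dart G v → Dart G v → Set
  a <ᶜʷ b = cwPos π a <ᵃ cwPos π b

  offset : Dart G v → ℚᵘ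
  offset d = proj₂ (cwPos π d)

  modalKey : Dart G v → ℕ × ℚᵘ
  modalKey d = rank d , offset d

  _<ᵐ_ _≤ᵐ_ : Dart G v → Dart G v → Set
  _<ᵐ_ = ×-Lex _≡_ ℕ._<_ Q._<_ on modalKey
  _≤ᵐ_ = ×-Lex _≡_ ℕ._<_ Q._≤_ on modalKey

  <ᵐ-trans : Transitive _<ᵐ_
  <ᵐ-trans {a} {b} {c} =
    ×-transitive {_≈₁_ = _≡_} {_<₂_ = Q._<_} isEquivalence (resp₂ ℕ._<_) ℕP.<-trans QP.<-trans
      {modalKey a} {modalKey b} {modalKey c}

  <ᵐ⇒rank≤ : ∀ {a b} → a <ᵐ b → rank a ℕ.≤ rank b
  <ᵐ⇒rank≤ = [ ℕP.<⇒≤ , ℕP.≤-reflexive ∘ proj₁ ]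

  <ᵐ-sorted⇒modal : ∀ {l} → Linked _<ᵐ_ l → Modal l
  <ᵐ-sorted⇒modal = map⁺ ∘ Linked.map <ᵐ⇒rank≤

  <ᵐ-sorted⇒head≤ᵐlast : ∀ {e r} → Linked _<ᵐ_ (e ∷ r) → e ≤ᵐ lastFrom e r
  <ᵐ-sorted⇒head≤ᵐlast sorted with Linked-head-last <ᵐ-trans sorted
  ... | inj₁ e≡last = inj₂ (cong rank e≡last , QP.≤-reflexive-≡ (cong offset e≡last))
  ... | inj₂ e<last = Sum.map₂ (Product.map₂ QP.<⇒≤) e<last

  -- Offsets of outgoing and incoming darts have numerators +1 and -1, so
  -- comparisons between darts of opposite directions evaluate to closed
  -- booleans: hence the absurd patterns below and the refl cases of
  -- ≤ᵐ⇒angle-large, where the angle straddles two quadrants.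
  <ᶜʷ-outLeft-closed : ∀ {a b} → a <ᶜʷ b → rank a ≡ 0 → rank b ≡ 0
  <ᶜʷ-outLeft-closed {dart _ out Lft _} {dart _ out Lft _} _  _ = refl
  <ᶜʷ-outLeft-closed {dart _ out Lft _} {dart _ out Rgt _} () _
  <ᶜʷ-outLeft-closed {dart _ out Lft _} {dart _ inc Rgt _} () _
  <ᶜʷ-outLeft-closed {dart _ out Lft _} {dart _ inc Lft _} () _
  <ᶜʷ-outLeft-closed {dart _ out Rgt _} _ ()
  <ᶜʷ-outLeft-closed {dart _ inc Rgt _} _ ()
  <ᶜʷ-outLeft-closed {dart _ inc Lft _} _ ()

  -- The clockwise order agrees with the modal order except at the single
  -- step where it wraps around to the outgoing left darts.
  <ᶜʷ⇒<ᵐ : ∀ {a b} → a <ᶜʷ b → rank a ≡ 0 ⊎ 0 ℕ.< rank b → a <ᵐ b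
  <ᶜʷ⇒<ᵐ {a@(dart _ out Lft _)} {b@(dart _ out Lft _)} a<b _ = inj₂ (refl , does⇒ (offset a QP.<? offset b) a<b)
  <ᶜʷ⇒<ᵐ {dart _ out Lft _} {dart _ out Rgt _} () _
  <ᶜʷ⇒<ᵐ {dart _ out Lft _} {dart _ inc Rgt _} () _
  <ᶜʷ⇒<ᵐ {dart _ out Lft _} {dart _ inc Lft _} () _
  <ᶜʷ⇒<ᵐ {dart _ out Rgt _} {dart _ out Lft _} _ (inj₁ ())
  <ᶜʷ⇒<ᵐ {dart _ out Rgt _} {dart _ out Lft _} _ (inj₂ ())
  <ᶜʷ⇒<ᵐ {a@(dart _ out Rgt _)} {b@(dart _ out Rgt _)} a<b _ = inj₂ (refl , does⇒ (offset a QP.<? offset b) a<b)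
  <ᶜʷ⇒<ᵐ {dart _ out Rgt _} {dart _ inc Rgt _} _ _ = inj₁ (s<s z<s)
  <ᶜʷ⇒<ᵐ {dart _ out Rgt _} {dart _ inc Lft _} _ _ = inj₁ (s<s z<s)
  <ᶜʷ⇒<ᵐ {dart _ inc Rgt _} {dart _ out Lft _} _ (inj₁ ())
  <ᶜʷ⇒<ᵐ {dart _ inc Rgt _} {dart _ out Lft _} _ (inj₂ ())
  <ᶜʷ⇒<ᵐ {dart _ inc Rgt _} {dart _ out Rgt _} () _
  <ᶜʷ⇒<ᵐ {a@(dart _ inc Rgt _)} {b@(dart _ inc Rgt _)} a<b _ = inj₂ (refl , does⇒ (offset a QP.<? offset b) a<b)
  <ᶜʷ⇒<ᵐ {dart _ inc Rgt _} {dart _ inc Lft _} _ _ = inj₁ (s<s (s<s z<s))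
  <ᶜʷ⇒<ᵐ {dart _ inc Lft _} {dart _ out Lft _} _ (inj₁ ())
  <ᶜʷ⇒<ᵐ {dart _ inc Lft _} {dart _ out Lft _} _ (inj₂ ())
  <ᶜʷ⇒<ᵐ {dart _ inc Lft _} {dart _ out Rgt _} () _
  <ᶜʷ⇒<ᵐ {dart _ inc Lft _} {dart _ inc Rgt _} () _
  <ᶜʷ⇒<ᵐ {a@(dart _ inc Lft _)} {b@(dart _ inc Lft _)} a<b _ = inj₂ (refl , does⇒ (offset a QP.<? offset b) a<b)

  ≤ᵐ⇒angle-large : ∀ {e₁ e₂} → dir e₁ ≡ dir e₂ → e₂ ≤ᵐ e₁ → lamΓ π e₁ e₂ ≡ + 1
  ≤ᵐ⇒angle-large {dart _ out _ _} {dart _ inc _ _} ()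
  ≤ᵐ⇒angle-large {dart _ inc _ _} {dart _ out _ _} ()
  ≤ᵐ⇒angle-large {e₁@(dart _ out Lft _)} {e₂@(dart _ out Lft _)} _ (inj₂ (_ , e₂≤e₁)) =
    if-T (wrapping-angle-large (offset e₂ Q.- offset e₁) (p≤q⇒p-q≯0 e₂≤e₁))
  ≤ᵐ⇒angle-large {dart _ out Lft _} {dart _ out Lft _} _ (inj₁ ())
  ≤ᵐ⇒angle-large {dart _ out Lft _} {dart _ out Rgt _} _ (inj₁ ())
  ≤ᵐ⇒angle-large {dart _ out Lft _} {dart _ out Rgt _} _ (inj₂ (() , _))
  ≤ᵐ⇒angle-large {dart _ out Rgt _} {dart _ out Lft _} _ (inj₁ _) = refl
  ≤ᵐ⇒angle-large {dart _ out Rgt _} {dart _ out Lft _} _ (inj₂ (() , _))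
  ≤ᵐ⇒angle-large {e₁@(dart _ out Rgt _)} {e₂@(dart _ out Rgt _)} _ (inj₂ (_ , e₂≤e₁)) =
    if-T (wrapping-angle-large (offset e₂ Q.- offset e₁) (p≤q⇒p-q≯0 e₂≤e₁))
  ≤ᵐ⇒angle-large {dart _ out Rgt _} {dart _ out Rgt _} _ (inj₁ (s<s ()))
  ≤ᵐ⇒angle-large {e₁@(dart _ inc Rgt _)} {e₂@(dart _ inc Rgt _)} _ (inj₂ (_ , e₂≤e₁)) =
    if-T (wrapping-angle-large (offset e₂ Q.- offset e₁) (p≤q⇒p-q≯0 e₂≤e₁))
  ≤ᵐ⇒angle-large {dart _ inc Rgt _} {dart _ inc Rgt _} _ (inj₁ (s<s (s<s ())))
  ≤ᵐ⇒angle-large {dart _ inc Rgt _} {dart _ inc Lft _} _ (inj₁ (s<s (s<s ())))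
  ≤ᵐ⇒angle-large {dart _ inc Rgt _} {dart _ inc Lft _} _ (inj₂ (() , _))
  ≤ᵐ⇒angle-large {dart _ inc Lft _} {dart _ inc Rgt _} _ (inj₁ _) = refl
  ≤ᵐ⇒angle-large {dart _ inc Lft _} {dart _ inc Rgt _} _ (inj₂ (() , _))
  ≤ᵐ⇒angle-large {e₁@(dart _ inc Lft _)} {e₂@(dart _ inc Lft _)} _ (inj₂ (_ , e₂≤e₁)) =
    if-T (wrapping-angle-large (offset e₂ Q.- offset e₁) (p≤q⇒p-q≯0 e₂≤e₁))
  ≤ᵐ⇒angle-large {dart _ inc Lft _} {dart _ inc Lft _} _ (inj₁ (s<s (s<s (s<s ()))))

  <ᶜʷ-sorted⇒outLeftFirst-<ᵐ-sorted : ∀ {l} → Linked _<ᶜʷ_ l → Linked _<ᵐ_ (outLeftFirst l)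
  <ᶜʷ-sorted⇒outLeftFirst-<ᵐ-sorted {l} sorted =
    Linked-++⁺ᴬ (λ b≡0 a>0 → inj₁ (subst (ℕ._< _) (sym b≡0) a>0))
      outLeftBlock restBlock
      (Linked-mapᴬ (λ a≡0 _ a<b → <ᶜʷ⇒<ᵐ a<b (inj₁ a≡0)) outLeftBlock (proj₂ sortedBlocks))
      (Linked-mapᴬ (λ _ b>0 a<b → <ᶜʷ⇒<ᵐ a<b (inj₂ b>0)) restBlock (proj₁ sortedBlocks))
    where
      sortedBlocks : Linked _<ᶜʷ_ (takeWhile rank>0? l) × Linked _<ᶜʷ_ (dropWhile rank>0? l)
      sortedBlocks = Linked-++⁻ (takeWhile rank>0? l)
        (subst (Linked _<ᶜʷ_) (sym (takeWhile++dropWhile rank>0? l)) sorted)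

      restBlock : All (λ d → 0 ℕ.< rank d) (takeWhile rank>0? l)
      restBlock = all-takeWhile rank>0? l

      outLeft : ∀ {ds} → Maybe.All (∁ (λ d → 0 ℕ.< rank d)) (head ds) →
                Linked _<ᶜʷ_ ds → All (λ d → rank d ≡ 0) ds
      outLeft {[]}    _               _  = []
      outLeft {_ ∷ _} (Maybe.just ≯0) ds =
        Linked-All-closed <ᶜʷ-outLeft-closed (ℕP.n≤0⇒n≡0 (ℕP.≮⇒≥ ≯0)) ds

      outLeftBlock : All (λ d → rank d ≡ 0) (dropWhile rank>0? l)
      outLeftBlock = outLeft (all-head-dropWhile rank>0? l) (proj₂ sortedBlocks)

module _ {n : ℕ} {G : PDigraph n} {π : Fin n → Fin n} {v : Fin n} where

  modal-rotation : ∀ {l : List (Dart G v)} → ClockwiseOrder π v l →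
                   ∃ λ l′ → IsRotation l l′ × Linked (_<ᵐ_ π) l′
  modal-rotation (_ , xs , ys , l≡ , sorted) =
    outLeftFirst (ys ++ xs) ,
    rotation-trans (xs , ys , l≡ , refl) (rotation-outLeftFirst (ys ++ xs)) ,
    <ᶜʷ-sorted⇒outLeftFirst-<ᵐ-sorted π sorted

  fourModalAt : (𝓔 : UpwardEmbedding G) → DefinedBy π 𝓔 → FourModalAt 𝓔 v
  fourModalAt 𝓔 (clockwise , lam≡) with modal-rotation (clockwise v)
  ... | [] , rot , _ = inj₁ (dartless⇒source none , dartless⇒sink none)
    where
      none : ¬ Dart G v
      none d = ¬Any[] (∈-resp-↭ (rotation-↭ rot) (proj₁ (clockwise v) d))
  ... | e ∷ r , rot@(xs , ys , l≡ , l′≡) , sorted =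
    inj₂ ((λ _ _ → xs , ys , l≡ , subst Modal (sym l′≡) modal) ,
          largeAngle ∘ source⇒out , largeAngle ∘ sink⇒inc)
    where
      modal : Modal (e ∷ r)
      modal = <ᵐ-sorted⇒modal π sorted

      largeAngle : ∀ {D} → (∀ d → dir d ≡ D) → ModalWithLargeAngle 𝓔 v
      largeAngle sameDir =
        xs , ys , e , r , l≡ , l′≡ ,
        trans (lam≡ v _ _ (rotation-cycAdj rot))
              (≤ᵐ⇒angle-large π {e₁ = lastFrom e r} {e₂ = e}
                 (trans (sameDir (lastFrom e r)) (sym (sameDir e)))
                 (<ᵐ-sorted⇒head≤ᵐlast π sorted)) ,
        modal

mainTheorem1 : (n : ℕ) (G : PDigraph n) (π : Fin n → Fin n) →
               IsUpwardBookEmbedding G π →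
               (𝓔 : UpwardEmbedding G) → DefinedBy π 𝓔 →
               FourModal 𝓔
mainTheorem1 n G π _ 𝓔 definedByΓ v = fourModalAt 𝓔 definedByΓ
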